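{- For all $n\geq0$, $j_n(321)=C_{\lfloor n/2\rfloor}$, where $C_m=\frac{1}{m+1}\binom{2m}{m}$ is the $m$th Catalan number.
   Context: A permutation of a finite set $S$ of positive integers is a word in which each element of $S$ appears exactly once; $\mathfrak{S}_n$ is the set of permutations of $\{1,\dots,n\}$. For a permutation $\pi$ and a letter $x$ of $\pi$, $\rho_\pi(x)$ is the maximal consecutive subword of $\pi$ consisting of the letters immediately to the right of $x$ that are all larger than $x$. $\pi$ is Jacobi if $|\rho_\pi(x)|$ is even for all letters $x$. A permutation $\pi$ avoids a pattern $\sigma$ if no subword of $\pi$ has standardization (relative order) $\sigma$. $j_n(321)$ is the number of $321$-avoiding Jacobi permutations in $\mathfrak{S}_n$. -}

module Defs where

open import Data.Nat using (ℕ; zero; suc; _<_; _/_; _*_)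
open import Data.Nat.Combinatorics using (_C_)
open import Data.List using (List; []; _∷_; length; upTo; map)
open import Data.List.Relation.Unary.All using (All)
open import Data.List.Relation.Binary.Sublist.Propositional using (_⊆_)
open import Data.List.Relation.Binary.Permutation.Propositional using (_↭_)
open import Data.Bool using (Bool; true; false; if_then_else_)
open import Data.Nat using (_<ᵇ_)
open import Relation.Nullary using (¬_)
open import Data.Product using (_×_)
open import Data.Unit using (⊤)

oneTo : ℕ → List ℕ
oneTo n = map suc (upTo n)

IsPerm : ℕ → List ℕ → Set
IsPerm n π = π ↭ oneTo n

runLen : ℕ → List ℕ → ℕ
runLen x [] = 0
runLen x (y ∷ ys) = if x <ᵇ y then suc (runLen x ys) else 0

data Even : ℕ → Set where
  even0  : Even 0
  evenSS : ∀ {n} → Even n → Even (suc (suc n))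

Jacobi : List ℕ → Set
Jacobi [] = ⊤
Jacobi (x ∷ xs) = Even (runLen x xs) × Jacobi xs

Avoids321 : List ℕ → Set
Avoids321 π = ∀ a b c → (a ∷ b ∷ c ∷ []) ⊆ π → ¬ (b < a × c < b)

catalan : ℕ → ℕ
catalan m = ((2 * m) C m) / suc m

J321 : ℕ → List ℕ → Set
J321 n π = IsPerm n π × Jacobi π × Avoids321 π

-- Read from the right, a 321-avoiding Jacobi word of even length with distinct letters is forced to be a
-- column word a₁ b₁ ⋯ aₘ bₘ (bᵢ < aᵢ, with the aᵢ and the bᵢ increasing): a letter x in front of a column
-- word a′ b′ ⋯ has a run of even length only if x > a′ or x lies below all later letters, and x > a′ > b′
-- is a 321. Conversely every column word is Jacobi and 321-avoiding, and a word of odd length qualifies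
-- exactly when it is its least letter followed by a column word. Column words on 2m letters are the standard
-- Young tableaux of shape (m, m); inserting the entries from the largest down, each at the front of one of
-- the two rows, follows the ballot recursion, and the ballot number C(2m, m) − C(2m, m − 1) is Cₘ.
module Submission where

open import Defs
open import Data.Nat using (ℕ; zero; suc; _+_; _*_; _/_; _≤_; _<_; _<ᵇ_; s<s)
open import Data.Nat.Properties
  using ( +-identityʳ; +-suc; +-assoc; +-comm; +-cancelʳ-≡; *-comm; *-zeroʳ; *-identityʳ; *-distribˡ-+
        ; suc-injective; +-commutativeSemigroup; m≤m+n; m+n∸m≡n
        ; ≤-refl; ≤-antisym; <⇒≤; <-≤-trans; <-trans; <-irrefl; <-asym; <⇒≱; <⇒≢; <-cmp
        ; n<1+n; m<n⇒m<1+n; <⇒<ᵇ; <ᵇ⇒< )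
open import Data.Nat.Divisibility using (divides)
open import Data.Nat.DivMod using (m*n/n≡m; +-distrib-/-∣ʳ)
open import Data.Nat.Combinatorics using (_C_; nCk≡nC[n∸k]; nCk+nC[k+1]≡[n+1]C[k+1]; nC1≡n)
open import Algebra.Properties.CommutativeSemigroup +-commutativeSemigroup using (interchange)
open import Data.Bool using (true; false)
open import Data.Empty using (⊥-elim)
open import Data.Unit using (⊤; tt)
open import Data.Product using (Σ; ∃-syntax; ∃₂; _×_; _,_; proj₁; proj₂; map₁; map₂; uncurry)
open import Data.Sum using (inj₁; inj₂)
open import Data.List using (List; []; _∷_; [_]; _++_; length; map; upTo)
open import Data.List.Properties using (length-map; length-++; length-applyUpTo; ∷-injective; ∷-injectiveʳ)
open import Data.List.Relation.Unary.All as All using (All; []; _∷_)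
import Data.List.Relation.Unary.All.Properties as All
open import Data.List.Relation.Unary.Any using (here; there)
open import Data.List.Relation.Unary.AllPairs as AllPairs using (AllPairs; []; _∷_)
import Data.List.Relation.Unary.AllPairs.Properties as AllPairs
open import Data.List.Relation.Unary.Unique.Propositional using (Unique)
import Data.List.Relation.Unary.Unique.Propositional.Properties as Unique
open import Data.List.Membership.Propositional using (_∈_)
open import Data.List.Membership.Propositional.Properties using (∈-map⁺; ∈-map⁻; ∈-++⁺ˡ; ∈-++⁺ʳ; ∈-++⁻)
open import Data.List.Relation.Binary.Sublist.Propositional using (_⊆_; []; _∷_; _∷ʳ_; minimum; lookup)
open import Data.List.Relation.Binary.Permutation.Propositional using (_↭_; ↭-refl; ↭-sym; ↭-trans; prep; ↭⇒↭ₛ)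
open import Data.List.Relation.Binary.Permutation.Propositional.Properties
  using (∈-resp-↭; All-resp-↭; shift; drop-∷; ↭-length; ↭-empty-inv)
open import Function using (id)
open import Function.Bundles using (_⇔_; mk⇔; Equivalence)
open import Function.Construct.Composition using (_⇔-∘_)
open import Relation.Binary using (tri<; tri≈; tri>)
open import Relation.Binary.PropositionalEquality
  using (_≡_; _≢_; refl; sym; trans; cong; cong₂; subst; setoid; module ≡-Reasoning)
open import Data.List.Relation.Binary.Permutation.Setoid.Properties (setoid ℕ) using (Unique-resp-↭)
open import Relation.Nullary using (¬_; contradiction)

-- Ballot numbers

-- ballot n e counts the walks of n steps ±1 from height e down to height 0 that never go below 0.
ballot : ℕ → ℕ → ℕ
ballot zero    zero    = 1
ballot zero    (suc e) = 0
ballot (suc n) zero    = ballot n 1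
ballot (suc n) (suc e) = ballot n (suc (suc e)) + ballot n e

ballot-vanishes : ∀ {n e} → n < e → ballot n e ≡ 0
ballot-vanishes {zero}  {suc e} _         = refl
ballot-vanishes {suc n} {suc e} (s<s n<e) =
  cong₂ _+_ (ballot-vanishes (m<n⇒m<1+n (m<n⇒m<1+n n<e))) (ballot-vanishes n<e)

ballot-diagonal : ∀ n → ballot n n ≡ 1
ballot-diagonal zero    = refl
ballot-diagonal (suc n) = cong₂ _+_ (ballot-vanishes (m<n⇒m<1+n (n<1+n n))) (ballot-diagonal n)

infixl 6.5 _C⁻_

_C⁻_ : ℕ → ℕ → ℕ
n C⁻ zero  = 0
n C⁻ suc k = n C k

C⁻-pascal : ∀ n k → n C⁻ k + n C k ≡ suc n C k
C⁻-pascal n zero    = refl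
C⁻-pascal n (suc k) = nCk+nC[k+1]≡[n+1]C[k+1] n k

C-sym : ∀ {n} k l → k + l ≡ n → n C k ≡ n C l
C-sym k l refl = trans (nCk≡nC[n∸k] (m≤m+n k l)) (cong ((k + l) C_) (m+n∸m≡n k l))

-- The walks counted by ballot n d have p up-steps and p + d down-steps.
ballot+C⁻≡C : ∀ n p d → n ≡ p + (p + d) → ballot n d + n C⁻ p ≡ n C p
ballot+C⁻≡C n       zero    d       refl = trans (+-identityʳ _) (ballot-diagonal d)
ballot+C⁻≡C zero    (suc p) d       ()
ballot+C⁻≡C (suc n) (suc p) zero    eq   = begin
  ballot n 1 + suc n C p         ≡⟨ cong (ballot n 1 +_) (C⁻-pascal n p) ⟨
  ballot n 1 + (n C⁻ p + n C p)  ≡⟨ +-assoc (ballot n 1) _ _ ⟨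
  ballot n 1 + n C⁻ p + n C p    ≡⟨ cong (_+ n C p) (ballot+C⁻≡C n p 1 (trans n≡ (cong (p +_) (+-comm 1 p)))) ⟩
  n C p + n C p                  ≡⟨ cong (n C p +_) (C-sym p (suc p) (sym n≡)) ⟩
  n C p + n C suc p              ≡⟨ nCk+nC[k+1]≡[n+1]C[k+1] n p ⟩
  suc n C suc p                  ∎
  where
  open ≡-Reasoning
  n≡ : n ≡ p + suc p
  n≡ = trans (suc-injective eq) (cong (λ x → p + suc x) (+-identityʳ p))
ballot+C⁻≡C (suc n) (suc p) (suc d) eq   = begin
  ballot n (2 + d) + ballot n d + suc n C p
    ≡⟨ cong (ballot n (2 + d) + ballot n d +_) (C⁻-pascal n p) ⟨
  ballot n (2 + d) + ballot n d + (n C⁻ p + n C p)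
    ≡⟨ interchange (ballot n (2 + d)) _ _ _ ⟩
  ballot n (2 + d) + n C⁻ p + (ballot n d + n C⁻ suc p)
    ≡⟨ cong₂ _+_ (ballot+C⁻≡C n p (2 + d) n≡₁) (ballot+C⁻≡C n (suc p) d n≡₂) ⟩
  n C p + n C suc p
    ≡⟨ nCk+nC[k+1]≡[n+1]C[k+1] n p ⟩
  suc n C suc p
    ∎
  where
  open ≡-Reasoning
  n≡ : n ≡ p + suc (p + suc d)
  n≡ = suc-injective eq
  n≡₁ : n ≡ p + (p + (2 + d))
  n≡₁ = trans n≡ (cong (p +_) (sym (+-suc p (suc d))))
  n≡₂ : n ≡ suc p + (suc p + d)
  n≡₂ = trans n≡ (trans (+-suc p _) (cong (λ x → suc (p + x)) (+-suc p d)))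

[k+1]*[n+1]C[k+1]≡[n+1]*nCk : ∀ n k → suc k * (suc n C suc k) ≡ suc n * (n C k)
[k+1]*[n+1]C[k+1]≡[n+1]*nCk zero    zero    = refl
[k+1]*[n+1]C[k+1]≡[n+1]*nCk zero    (suc k) = *-zeroʳ (2 + k)
[k+1]*[n+1]C[k+1]≡[n+1]*nCk (suc n) zero    =
  trans (+-identityʳ _) (trans (nC1≡n (2 + n)) (sym (*-identityʳ (2 + n))))
[k+1]*[n+1]C[k+1]≡[n+1]*nCk (suc n) (suc k) = begin
  (2 + k) * ((2 + n) C (2 + k))
    ≡⟨ cong ((2 + k) *_) (nCk+nC[k+1]≡[n+1]C[k+1] (suc n) (suc k)) ⟨
  (2 + k) * (X + Y)
    ≡⟨ *-distribˡ-+ (2 + k) X Y ⟩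
  X + suc k * X + (2 + k) * Y
    ≡⟨ +-assoc X _ _ ⟩
  X + (suc k * X + (2 + k) * Y)
    ≡⟨ cong (X +_) (cong₂ _+_ ([k+1]*[n+1]C[k+1]≡[n+1]*nCk n k) ([k+1]*[n+1]C[k+1]≡[n+1]*nCk n (suc k))) ⟩
  X + (suc n * (n C k) + suc n * (n C suc k))
    ≡⟨ cong (X +_) (*-distribˡ-+ (suc n) (n C k) _) ⟨
  X + suc n * (n C k + n C suc k)
    ≡⟨ cong (λ x → X + suc n * x) (nCk+nC[k+1]≡[n+1]C[k+1] n k) ⟩
  (2 + n) * X
    ∎
  where
  open ≡-Reasoning
  X = suc n C suc k
  Y = suc n C (2 + k)

[m+1]*[2m]C⁻m≡m*[2m]Cm : ∀ m {n} → n ≡ m + m → suc m * (n C⁻ m) ≡ m * (n C m)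
[m+1]*[2m]C⁻m≡m*[2m]Cm zero    refl = refl
[m+1]*[2m]C⁻m≡m*[2m]Cm (suc k) refl = begin
  (2 + k) * (N C k)        ≡⟨ cong ((2 + k) *_) (C-sym k (2 + k) (+-suc k (suc k))) ⟩
  (2 + k) * (N C (2 + k))  ≡⟨ [k+1]*[n+1]C[k+1]≡[n+1]*nCk M (suc k) ⟩
  N * (M C suc k)          ≡⟨ cong (N *_) (C-sym (suc k) k (sym (+-suc k k))) ⟩
  N * (M C k)              ≡⟨ [k+1]*[n+1]C[k+1]≡[n+1]*nCk M k ⟨
  suc k * (N C suc k)      ∎
  where
  open ≡-Reasoning
  M = k + suc k
  N = suc M

ballot≡catalan : ∀ m → ballot (2 * m) 0 ≡ catalan m
ballot≡catalan m = sym (begin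
  c / suc m          ≡⟨ cong (_/ suc m) b*[1+m]≡c ⟨
  b * suc m / suc m  ≡⟨ m*n/n≡m b (suc m) ⟩
  b                  ∎)
  where
  open ≡-Reasoning
  b = ballot (2 * m) 0
  c = 2 * m C m
  centralC⁻ : suc m * (2 * m C⁻ m) ≡ m * c
  centralC⁻ = [m+1]*[2m]C⁻m≡m*[2m]Cm m (cong (m +_) (+-identityʳ m))
  b*[1+m]≡c : b * suc m ≡ c
  b*[1+m]≡c = +-cancelʳ-≡ (m * c) _ _ (begin
    b * suc m + m * c                ≡⟨ cong₂ _+_ (*-comm b (suc m)) (sym centralC⁻) ⟩
    suc m * b + suc m * (2 * m C⁻ m) ≡⟨ *-distribˡ-+ (suc m) b _ ⟨
    suc m * (b + 2 * m C⁻ m)         ≡⟨ cong (suc m *_) (ballot+C⁻≡C (2 * m) m 0 refl) ⟩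
    suc m * c                        ∎)

-- Column words

runLen-< : ∀ {x y} w → x < y → runLen x (y ∷ w) ≡ suc (runLen x w)
runLen-< {x} {y} w x<y with x <ᵇ y | <⇒<ᵇ x<y
... | true | _ = refl

runLen-> : ∀ {x y} w → y < x → runLen x (y ∷ w) ≡ 0
runLen-> {x} {y} w y<x with x <ᵇ y | <ᵇ⇒< x y
... | false | _   = refl
... | true  | x<y = contradiction (x<y _) (<-asym y<x)

runLen-all : ∀ {x w} → All (x <_) w → runLen x w ≡ length w
runLen-all             []          = refl
runLen-all {w = _ ∷ w} (x<y ∷ x<w) = trans (runLen-< w x<y) (cong suc (runLen-all x<w))

¬Even-suc : ∀ {n} → Even n → ¬ Even (suc n)
¬Even-suc (evenSS e) (evenSS e′) = ¬Even-suc e e′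

NextColumnLarger : ℕ → ℕ → List ℕ → Set
NextColumnLarger a b (a′ ∷ b′ ∷ _) = a < a′ × b < b′
NextColumnLarger _ _ _             = ⊤

-- a₁ b₁ a₂ b₂ ⋯ aₘ bₘ with bᵢ < aᵢ, a₁ < a₂ < ⋯ and b₁ < b₂ < ⋯: the column reading word of the
-- standard Young tableau with top row b₁ b₂ ⋯ bₘ and bottom row a₁ a₂ ⋯ aₘ.
data ColumnWord : List ℕ → Set where
  []  : ColumnWord []
  col : ∀ {a b w} → b < a → NextColumnLarger a b w → ColumnWord w → ColumnWord (a ∷ b ∷ w)

columnWord-even : ∀ {w} → ColumnWord w → Even (length w)
columnWord-even []           = even0
columnWord-even (col _ _ cw) = evenSS (columnWord-even cw)

columnWord-second<rest : ∀ {a b w} → ColumnWord (a ∷ b ∷ w) → All (b <_) w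
columnWord-second<rest (col _ _ [])                            = []
columnWord-second<rest (col _ (_ , b<b′) cw@(col b′<a′ _ _)) =
  <-trans b<b′ b′<a′ ∷ b<b′ ∷ All.map (<-trans b<b′) (columnWord-second<rest cw)

columnWord-jacobi : ∀ {w} → ColumnWord w → Jacobi w
columnWord-jacobi []                       = tt
columnWord-jacobi c@(col {w = w} b<a _ cw) =
  subst Even (sym (runLen-> w b<a)) even0 ,
  subst Even (sym (runLen-all (columnWord-second<rest c))) (columnWord-even cw) ,
  columnWord-jacobi cw

InversionsAbove : ℕ → List ℕ → Set
InversionsAbove x w = ∀ {y z} → (y ∷ z ∷ []) ⊆ w → z < y → x ≤ y

avoids321-∷ : ∀ {x w} → InversionsAbove x w → Avoids321 w → Avoids321 (x ∷ w)
avoids321-∷ _   avoids a b c (_ ∷ʳ s)                 = avoids a b c s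
avoids321-∷ inv _      a b c (refl ∷ s) (b<a , c<b) = <⇒≱ b<a (inv s c<b)

avoids321-tail : ∀ {x w} → Avoids321 (x ∷ w) → Avoids321 w
avoids321-tail avoids a b c s = avoids a b c (_ ∷ʳ s)

inversionsAbove-least : ∀ {x w} → All (x <_) w → InversionsAbove x w
inversionsAbove-least x<w s _ = <⇒≤ (All.lookup x<w (lookup s (here refl)))

columnWord-inversionsAbove : ∀ {a b w} → ColumnWord (a ∷ b ∷ w) → InversionsAbove a (a ∷ b ∷ w)
columnWord-inversionsAbove _ (refl ∷ _) _ = ≤-refl
columnWord-inversionsAbove c (_ ∷ʳ (refl ∷ s)) z<b =
  contradiction (All.lookup (columnWord-second<rest c) (lookup s (here refl))) (<-asym z<b)
columnWord-inversionsAbove (col _ (a<a′ , _) cw@(col _ _ _)) (_ ∷ʳ (_ ∷ʳ s)) z<y =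
  <⇒≤ (<-≤-trans a<a′ (columnWord-inversionsAbove cw s z<y))

columnWord-avoids321 : ∀ {w} → ColumnWord w → Avoids321 w
columnWord-avoids321 []             _ _ _ ()
columnWord-avoids321 c@(col _ _ cw) =
  avoids321-∷ (λ s → columnWord-inversionsAbove c (_ ∷ʳ s))
    (avoids321-∷ (inversionsAbove-least (columnWord-second<rest c)) (columnWord-avoids321 cw))

-- x > a′ > b′ would be a 321, and a′ > x > b′ would make the run of x odd.
below-columnWord : ∀ {x w} → ColumnWord w → All (x ≢_) w → Avoids321 (x ∷ w) → Even (runLen x w) →
                   All (x <_) w
below-columnWord [] _ _ _ = []
below-columnWord {x} c@(col {a′} {b′} {w} b′<a′ _ _) x≢w avoids even with <-cmp x a′
... | tri≈ _ x≡a′ _ = ⊥-elim (All.head x≢w x≡a′)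
... | tri> _ _ a′<x = ⊥-elim (avoids x a′ b′ (refl ∷ refl ∷ refl ∷ minimum w) (a′<x , b′<a′))
... | tri< x<a′ _ _ with <-cmp x b′
...   | tri< x<b′ _ _ = x<a′ ∷ x<b′ ∷ All.map (<-trans x<b′) (columnWord-second<rest c)
...   | tri≈ _ x≡b′ _ = ⊥-elim (All.head (All.tail x≢w) x≡b′)
...   | tri> _ _ b′<x =
  ⊥-elim (¬Even-suc even0 (subst Even (trans (runLen-< (b′ ∷ w) x<a′) (cong suc (runLen-> w b′<x))) even))

avoids321⇒nextColumnLarger : ∀ {a b w} → ColumnWord w → All (a ≢_) w → Avoids321 (a ∷ b ∷ w) → All (b <_) w →
                             NextColumnLarger a b w
avoids321⇒nextColumnLarger [] _ _ _ = tt
avoids321⇒nextColumnLarger {a} {b} (col {a′} {b′} {w} b′<a′ _ _) a≢w avoids b<w with <-cmp a a′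
... | tri< a<a′ _ _ = a<a′ , All.head (All.tail b<w)
... | tri≈ _ a≡a′ _ = ⊥-elim (All.head a≢w a≡a′)
... | tri> _ _ a′<a = ⊥-elim (avoids a a′ b′ (refl ∷ b ∷ʳ refl ∷ refl ∷ minimum w) (a′<a , b′<a′))

jacobi⇒columnWord : ∀ {w} → Unique w → Even (length w) → Jacobi w → Avoids321 w → ColumnWord w
jacobi⇒columnWord {[]}        _                        _          _              _      = []
jacobi⇒columnWord {a ∷ b ∷ w} ((a≢b ∷ a≢w) ∷ b≢w ∷ uw) (evenSS e) (ja , jb , jw) avoids =
  col b<a (avoids321⇒nextColumnLarger cw a≢w avoids b<w) cw
  where
  cw : ColumnWord w
  cw = jacobi⇒columnWord uw e jw (avoids321-tail (avoids321-tail avoids))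
  b<w : All (b <_) w
  b<w = below-columnWord cw b≢w (avoids321-tail avoids) jb
  b<a : b < a
  b<a with <-cmp a b
  ... | tri< a<b _ _ = ⊥-elim (¬Even-suc e (subst Even (runLen-all (a<b ∷ All.map (<-trans a<b) b<w)) ja))
  ... | tri≈ _ a≡b _ = ⊥-elim (a≢b a≡b)
  ... | tri> _ _ b<a = b<a

jacobi⇒below∷columnWord : ∀ {x w} → Unique (x ∷ w) → Even (length w) → Jacobi (x ∷ w) → Avoids321 (x ∷ w) →
                          All (x <_) w × ColumnWord w
jacobi⇒below∷columnWord (x≢w ∷ uw) even (jx , jw) avoids = below-columnWord cw x≢w avoids jx , cw
  where cw = jacobi⇒columnWord uw even jw (avoids321-tail avoids)

-- Two-row tableaux

least-≤ : ∀ {v w vs} → All (v <_) vs → w ∈ v ∷ vs → v ≤ w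
least-≤ _    (here refl) = ≤-refl
least-≤ v<vs (there w∈)  = <⇒≤ (All.lookup v<vs w∈)

least-unique : ∀ {a as v vs} → All (a <_) as → All (v <_) vs → a ∈ v ∷ vs → v ∈ a ∷ as → a ≡ v
least-unique a<as v<vs a∈ v∈ = ≤-antisym (least-≤ a<as v∈) (least-≤ v<vs a∈)

-- Columns e as bs: the row bs on top of the row as, aligned on the right, with as sticking out by e cells
-- on the left, and b < a in every column.
data Columns : ℕ → List ℕ → List ℕ → Set where
  []    : Columns 0 [] []
  _∷_   : ∀ {a b as bs} → b < a → Columns 0 as bs → Columns 0 (a ∷ as) (b ∷ bs)
  extra : ∀ {e a as bs} → Columns e as bs → Columns (suc e) (a ∷ as) bs

columns-∷-top : ∀ {e v as bs} → All (v <_) as → Columns (suc e) as bs → Columns e as (v ∷ bs)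
columns-∷-top {zero}  (v<a ∷ _)    (extra c) = v<a ∷ c
columns-∷-top {suc e} (_   ∷ v<as) (extra c) = extra (columns-∷-top v<as c)

columns-tail-top : ∀ {e b as bs} → Columns e as (b ∷ bs) → Columns (suc e) as bs
columns-tail-top (_ ∷ c)   = extra c
columns-tail-top (extra c) = extra (columns-tail-top c)

columns-tail-bottom : ∀ {e a as bs} → Columns (suc e) (a ∷ as) bs → Columns e as bs
columns-tail-bottom (extra c) = c

record IsTableau (e : ℕ) (as bs : List ℕ) : Set where
  constructor tableau
  field
    bottom-increasing : AllPairs _<_ as
    top-increasing    : AllPairs _<_ bs
    columns           : Columns e as bs

open IsTableau using (columns)

tableaux : List ℕ → ℕ → List (List ℕ × List ℕ)
tableaux []       zero    = [ [] , [] ]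
tableaux []       (suc e) = []
tableaux (v ∷ vs) zero    = map (map₂ (v ∷_)) (tableaux vs 1)
tableaux (v ∷ vs) (suc e) = map (map₂ (v ∷_)) (tableaux vs (2 + e)) ++ map (map₁ (v ∷_)) (tableaux vs e)

tableaux-length : ∀ vs e → length (tableaux vs e) ≡ ballot (length vs) e
tableaux-length []       zero    = refl
tableaux-length []       (suc e) = refl
tableaux-length (v ∷ vs) zero    = trans (length-map _ (tableaux vs 1)) (tableaux-length vs 1)
tableaux-length (v ∷ vs) (suc e) = begin
  length (tops ++ bottoms)
    ≡⟨ length-++ tops ⟩
  length tops + length bottoms
    ≡⟨ cong₂ _+_ (length-map _ (tableaux vs (2 + e))) (length-map _ (tableaux vs e)) ⟩
  length (tableaux vs (2 + e)) + length (tableaux vs e)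
    ≡⟨ cong₂ _+_ (tableaux-length vs (2 + e)) (tableaux-length vs e) ⟩
  ballot (length vs) (2 + e) + ballot (length vs) e
    ∎
  where
  open ≡-Reasoning
  tops    = map (map₂ (v ∷_)) (tableaux vs (2 + e))
  bottoms = map (map₁ (v ∷_)) (tableaux vs e)

∈-tableaux-top : ∀ {v vs e as bs} → (as , bs) ∈ tableaux vs (suc e) → (as , v ∷ bs) ∈ tableaux (v ∷ vs) e
∈-tableaux-top {e = zero}  t∈ = ∈-map⁺ _ t∈
∈-tableaux-top {e = suc e} t∈ = ∈-++⁺ˡ (∈-map⁺ _ t∈)

∈-tableaux-bottom : ∀ {v vs e as bs} → (as , bs) ∈ tableaux vs e → (v ∷ as , bs) ∈ tableaux (v ∷ vs) (suc e)
∈-tableaux-bottom t∈ = ∈-++⁺ʳ _ (∈-map⁺ _ t∈)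

tableau-∷-top : ∀ {v vs e as bs} → All (v <_) vs → IsTableau (suc e) as bs × as ++ bs ↭ vs →
                IsTableau e as (v ∷ bs) × as ++ v ∷ bs ↭ v ∷ vs
tableau-∷-top {v} {as = as} {bs} v<vs (tableau ias ibs c , p) =
  tableau ias (v<bs ∷ ibs) (columns-∷-top v<as c) , ↭-trans (shift v as bs) (prep v p)
  where
  v<as = proj₁ (All.++⁻ as (All-resp-↭ (↭-sym p) v<vs))
  v<bs = proj₂ (All.++⁻ as (All-resp-↭ (↭-sym p) v<vs))

tableau-∷-bottom : ∀ {v vs e as bs} → All (v <_) vs → IsTableau e as bs × as ++ bs ↭ vs →
                   IsTableau (suc e) (v ∷ as) bs × v ∷ as ++ bs ↭ v ∷ vs
tableau-∷-bottom {v} {as = as} v<vs (tableau ias ibs c , p) =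
  tableau (proj₁ (All.++⁻ as (All-resp-↭ (↭-sym p) v<vs)) ∷ ias) ibs (extra c) , prep v p

tableaux-sound : ∀ {vs e as bs} → AllPairs _<_ vs → (as , bs) ∈ tableaux vs e →
                 IsTableau e as bs × as ++ bs ↭ vs
tableaux-sound {[]}     {zero}  _            (here refl) = tableau [] [] [] , ↭-refl
tableaux-sound {v ∷ vs} {zero}  (v<vs ∷ ivs) t∈ with ∈-map⁻ _ t∈
... | _ , t∈′ , refl = tableau-∷-top v<vs (tableaux-sound ivs t∈′)
tableaux-sound {v ∷ vs} {suc e} (v<vs ∷ ivs) t∈ with ∈-++⁻ (map (map₂ (v ∷_)) (tableaux vs (2 + e))) t∈
... | inj₁ t∈ᵗ with ∈-map⁻ _ t∈ᵗ
...   | _ , t∈′ , refl = tableau-∷-top v<vs (tableaux-sound ivs t∈′)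
tableaux-sound {v ∷ vs} {suc e} (v<vs ∷ ivs) t∈ | inj₂ t∈ᵇ with ∈-map⁻ _ t∈ᵇ
...   | _ , t∈′ , refl = tableau-∷-bottom v<vs (tableaux-sound ivs t∈′)

data LeastEntry (v : ℕ) : List ℕ → List ℕ → Set where
  bottom : ∀ {as bs} → LeastEntry v (v ∷ as) bs
  top    : ∀ {as bs} → LeastEntry v as (v ∷ bs)

leastEntry : ∀ {e v vs as bs} → All (v <_) vs → IsTableau e as bs → as ++ bs ↭ v ∷ vs → LeastEntry v as bs
leastEntry {as = as} v<vs t p with ∈-++⁻ as (∈-resp-↭ (↭-sym p) (here refl))
leastEntry {as = a ∷ as} v<vs (tableau (a<as ∷ _) _ _) p | inj₁ v∈as
  with least-unique a<as v<vs (∈-resp-↭ p (here refl)) v∈as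
... | refl = bottom
leastEntry {as = as} {b ∷ bs} v<vs (tableau _ (b<bs ∷ _) _) p | inj₂ v∈bs
  with least-unique b<bs v<vs (∈-resp-↭ p (∈-++⁺ʳ as (here refl))) v∈bs
... | refl = top

tableaux-complete : ∀ {vs e as bs} → AllPairs _<_ vs → IsTableau e as bs → as ++ bs ↭ vs →
                    (as , bs) ∈ tableaux vs e
tableaux-complete {[]} {as = []}    {[]}    _ (tableau _ _ []) _ = here refl
tableaux-complete {[]} {as = _ ∷ _}         _ _ p with ↭-empty-inv p
... | ()
tableaux-complete {[]} {as = []}    {_ ∷ _} _ _ p with ↭-empty-inv p
... | ()
tableaux-complete {v ∷ vs} (v<vs ∷ ivs) t p with leastEntry v<vs t p
-- Without overhang, the least entry v in the bottom row would have a smaller entry above it.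
tableaux-complete {v ∷ vs} {zero} {v ∷ as} (v<vs ∷ ivs) (tableau _ _ (b<v ∷ _)) p | bottom =
  ⊥-elim (<⇒≱ b<v (least-≤ v<vs (∈-resp-↭ p (∈-++⁺ʳ (v ∷ as) (here refl)))))
tableaux-complete {v ∷ vs} {suc e} (v<vs ∷ ivs) (tableau (_ ∷ ias) ibs c) p | bottom =
  ∈-tableaux-bottom {vs = vs} (tableaux-complete ivs (tableau ias ibs (columns-tail-bottom c)) (drop-∷ p))
tableaux-complete {v ∷ vs} {as = as} (v<vs ∷ ivs) (tableau ias (_ ∷ ibs) c) p | top =
  ∈-tableaux-top {vs = vs}
    (tableaux-complete ivs (tableau ias ibs (columns-tail-top c)) (drop-∷ (↭-trans (↭-sym (shift v as _)) p)))

map₁-∷-injective : ∀ {v} {s t : List ℕ × List ℕ} → map₁ (v ∷_) s ≡ map₁ (v ∷_) t → s ≡ t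
map₁-∷-injective {s = _ , _} {_ , _} refl = refl

map₂-∷-injective : ∀ {v} {s t : List ℕ × List ℕ} → map₂ (v ∷_) s ≡ map₂ (v ∷_) t → s ≡ t
map₂-∷-injective {s = _ , _} {_ , _} refl = refl

tableaux-unique : ∀ {vs e} → AllPairs _<_ vs → Unique (tableaux vs e)
tableaux-unique {[]}     {zero}  _            = [] ∷ []
tableaux-unique {[]}     {suc e} _            = []
tableaux-unique {v ∷ vs} {zero}  (_ ∷ ivs)    = Unique.map⁺ map₂-∷-injective (tableaux-unique {e = 1} ivs)
tableaux-unique {v ∷ vs} {suc e} (v<vs ∷ ivs) =
  Unique.++⁺ (Unique.map⁺ map₂-∷-injective (tableaux-unique {e = 2 + e} ivs))
             (Unique.map⁺ map₁-∷-injective (tableaux-unique {e = e} ivs))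
             disjoint
  where
  disjoint : ∀ {t} → ¬ (t ∈ map (map₂ (v ∷_)) (tableaux vs (2 + e)) × t ∈ map (map₁ (v ∷_)) (tableaux vs e))
  disjoint (t∈ᵗ , t∈ᵇ) with ∈-map⁻ _ t∈ᵗ | ∈-map⁻ _ t∈ᵇ
  ... | _ , t∈ , refl | _ , _ , refl =
    <-irrefl refl (All.lookup v<vs (∈-resp-↭ (proj₂ (tableaux-sound ivs t∈)) (here refl)))

interleave : List ℕ → List ℕ → List ℕ
interleave (a ∷ as) (b ∷ bs) = a ∷ b ∷ interleave as bs
interleave _        _        = []

interleave-↭ : ∀ {as bs} → Columns 0 as bs → interleave as bs ↭ as ++ bs
interleave-↭ []                        = ↭-refl
interleave-↭ {a ∷ as} {b ∷ bs} (_ ∷ c) = prep a (↭-trans (prep b (interleave-↭ c)) (↭-sym (shift b as bs)))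

interleave-injective : ∀ {as bs as′ bs′} → Columns 0 as bs → Columns 0 as′ bs′ →
                       interleave as bs ≡ interleave as′ bs′ → (as , bs) ≡ (as′ , bs′)
interleave-injective [] [] _ = refl
interleave-injective (_ ∷ c) (_ ∷ c′) eq with ∷-injective eq
... | refl , eq′ with ∷-injective eq′
...   | refl , eq″ with interleave-injective c c′ eq″
...     | refl = refl

nextColumnLarger⇔below : ∀ {a b as bs} → IsTableau 0 as bs →
                         NextColumnLarger a b (interleave as bs) ⇔ (All (a <_) as × All (b <_) bs)
nextColumnLarger⇔below (tableau _ _ []) = mk⇔ (λ _ → [] , []) (λ _ → tt)
nextColumnLarger⇔below (tableau (a′<as ∷ _) (b′<bs ∷ _) (_ ∷ _)) = mk⇔
  (λ (a<a′ , b<b′) → a<a′ ∷ All.map (<-trans a<a′) a′<as , b<b′ ∷ All.map (<-trans b<b′) b′<bs)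
  (λ (a<as , b<bs) → All.head a<as , All.head b<bs)

interleave-columnWord : ∀ {as bs} → IsTableau 0 as bs → ColumnWord (interleave as bs)
interleave-columnWord (tableau [] [] []) = []
interleave-columnWord (tableau (a<as ∷ ias) (b<bs ∷ ibs) (b<a ∷ c)) =
  col b<a (Equivalence.from (nextColumnLarger⇔below t) (a<as , b<bs)) (interleave-columnWord t)
  where t = tableau ias ibs c

columnWord⇒tableau : ∀ {w} → ColumnWord w → ∃₂ λ as bs → IsTableau 0 as bs × interleave as bs ≡ w
columnWord⇒tableau [] = [] , [] , tableau [] [] [] , refl
columnWord⇒tableau (col {a} {b} b<a next cw) with columnWord⇒tableau cw
... | as , bs , t@(tableau ias ibs c) , refl =
  a ∷ as , b ∷ bs , tableau (a<as ∷ ias) (b<bs ∷ ibs) (b<a ∷ c) , refl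
  where
  a<as = proj₁ (Equivalence.to (nextColumnLarger⇔below t) next)
  b<bs = proj₂ (Equivalence.to (nextColumnLarger⇔below t) next)

Enumeration : {A : Set} → (A → Set) → ℕ → Set
Enumeration {A} P k = Σ (List A) λ L → Unique L × (∀ x → x ∈ L ⇔ P x) × length L ≡ k

module _ {A : Set} {P : A → Set} {k : ℕ} where

  enumeration-⇔ : {Q : A → Set} → (∀ x → P x ⇔ Q x) → Enumeration P k → Enumeration Q k
  enumeration-⇔ P⇔Q (L , unique , ∈⇔P , length≡k) = L , unique , (λ x → P⇔Q x ⇔-∘ ∈⇔P x) , length≡k

  enumeration-map : {B : Set} (f : A → B) → (∀ {x y} → P x → P y → f x ≡ f y → x ≡ y) →
                    Enumeration P k → Enumeration (λ y → ∃[ x ] P x × f x ≡ y) k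
  enumeration-map f injective (L , unique , ∈⇔P , length≡k) =
    map f L , unique-map (All.tabulate (Equivalence.to (∈⇔P _))) unique ,
    (λ y → mk⇔ (∈-map⇒image y) image⇒∈-map) ,
    trans (length-map f L) length≡k
    where
    ∈-map⇒image : ∀ y → y ∈ map f L → ∃[ x ] P x × f x ≡ y
    ∈-map⇒image y y∈ with ∈-map⁻ f y∈
    ... | x , x∈ , refl = x , Equivalence.to (∈⇔P x) x∈ , refl
    image⇒∈-map : ∀ {y} → ∃[ x ] P x × f x ≡ y → y ∈ map f L
    image⇒∈-map (x , Px , refl) = ∈-map⁺ f (Equivalence.from (∈⇔P x) Px)
    unique-map : ∀ {xs} → All P xs → Unique xs → Unique (map f xs)
    unique-map []         []              = []
    unique-map (Px ∷ Pxs) (x≢xs ∷ unique) =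
      All.map⁺ (All.zipWith (λ (Py , x≢y) fx≡fy → x≢y (injective Px Py fx≡fy)) (Pxs , x≢xs)) ∷
      unique-map Pxs unique

tableaux-enumeration : ∀ {vs} e → AllPairs _<_ vs →
                       Enumeration (uncurry λ as bs → IsTableau e as bs × as ++ bs ↭ vs) (ballot (length vs) e)
tableaux-enumeration {vs} e increasing =
  tableaux vs e , tableaux-unique increasing ,
  (λ (as , bs) → mk⇔ (tableaux-sound increasing) (uncurry (tableaux-complete increasing))) ,
  tableaux-length vs e

columnWords : ∀ {vs} m → AllPairs _<_ vs → length vs ≡ 2 * m →
              Enumeration (λ π → ColumnWord π × π ↭ vs) (catalan m)
columnWords {vs} m increasing length≡ =
  subst (Enumeration _) (trans (cong (λ l → ballot l 0) length≡) (ballot≡catalan m))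
    (enumeration-⇔ tableau⇔columnWord
      (enumeration-map (uncurry interleave) (λ (t , _) (t′ , _) → interleave-injective (columns t) (columns t′))
        (tableaux-enumeration 0 increasing)))
  where
  tableau⇔columnWord : ∀ π → (∃[ (as , bs) ] (IsTableau 0 as bs × as ++ bs ↭ vs) × interleave as bs ≡ π) ⇔
                             (ColumnWord π × π ↭ vs)
  tableau⇔columnWord π = mk⇔
    (λ { (_ , (t , p) , refl) → interleave-columnWord t , ↭-trans (interleave-↭ (columns t)) p })
    (λ (cw , p) → let (as , bs , t , eq) = columnWord⇒tableau cw in
       (as , bs) , (t , ↭-trans (↭-sym (interleave-↭ (columns t))) (subst (_↭ vs) (sym eq) p)) , eq)

-- 321-avoiding Jacobi permutations

even-2* : ∀ m → Even (2 * m)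
even-2* zero    = even0
even-2* (suc m) = subst Even (cong suc (sym (+-suc m (m + 0)))) (evenSS (even-2* m))

-- J321 n is definitionally Jacobi321 (oneTo n).
Jacobi321 : List ℕ → List ℕ → Set
Jacobi321 vs π = π ↭ vs × Jacobi π × Avoids321 π

unique-↭-increasing : ∀ {vs π} → AllPairs _<_ vs → π ↭ vs → Unique π
unique-↭-increasing increasing p = Unique-resp-↭ (↭⇒↭ₛ (↭-sym p)) (AllPairs.map <⇒≢ increasing)

jacobi321-even : ∀ {vs} m → AllPairs _<_ vs → length vs ≡ 2 * m → Enumeration (Jacobi321 vs) (catalan m)
jacobi321-even {vs} m increasing length≡ = enumeration-⇔ columnWord⇔jacobi321 (columnWords m increasing length≡)
  where
  columnWord⇔jacobi321 : ∀ π → (ColumnWord π × π ↭ vs) ⇔ Jacobi321 vs π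
  columnWord⇔jacobi321 π = mk⇔
    (λ (cw , p) → p , columnWord-jacobi cw , columnWord-avoids321 cw)
    (λ (p , jacobi , avoids) →
      jacobi⇒columnWord (unique-↭-increasing increasing p)
                        (subst Even (sym (trans (↭-length p) length≡)) (even-2* m)) jacobi avoids , p)

x∷columnWord⇒jacobi321 : ∀ {x vs w} → All (x <_) vs → ColumnWord w → w ↭ vs → Jacobi321 (x ∷ vs) (x ∷ w)
x∷columnWord⇒jacobi321 x<vs cw p =
  prep _ p ,
  (subst Even (sym (runLen-all x<w)) (columnWord-even cw) , columnWord-jacobi cw) ,
  avoids321-∷ (inversionsAbove-least x<w) (columnWord-avoids321 cw)
  where x<w = All-resp-↭ (↭-sym p) x<vs

jacobi321⇒x∷columnWord : ∀ {x vs π} → AllPairs _<_ (x ∷ vs) → Even (length vs) → Jacobi321 (x ∷ vs) π →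
                         ∃[ w ] (ColumnWord w × w ↭ vs) × x ∷ w ≡ π
jacobi321⇒x∷columnWord {π = []} _ _ (p , _) with ↭-length p
... | ()
jacobi321⇒x∷columnWord {π = y ∷ w} increasing@(x<vs ∷ _) even (p , jacobi , avoids)
  with jacobi⇒below∷columnWord (unique-↭-increasing increasing p)
                               (subst Even (suc-injective (sym (↭-length p))) even) jacobi avoids
... | y<w , cw with least-unique y<w x<vs (∈-resp-↭ p (here refl)) (∈-resp-↭ (↭-sym p) (here refl))
...   | refl = w , (cw , drop-∷ p) , refl

jacobi321-odd : ∀ {x vs} m → AllPairs _<_ (x ∷ vs) → length vs ≡ 2 * m →
                Enumeration (Jacobi321 (x ∷ vs)) (catalan m)
jacobi321-odd {x} {vs} m increasing@(x<vs ∷ vs-increasing) length≡ =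
  enumeration-⇔
    (λ π → mk⇔ (λ { (w , (cw , p) , refl) → x∷columnWord⇒jacobi321 x<vs cw p })
               (jacobi321⇒x∷columnWord increasing (subst Even (sym length≡) (even-2* m))))
    (enumeration-map (x ∷_) (λ _ _ → ∷-injectiveʳ) (columnWords m vs-increasing length≡))

oneTo-increasing : ∀ n → AllPairs _<_ (oneTo n)
oneTo-increasing n = AllPairs.map⁺ (AllPairs.map s<s (AllPairs.applyUpTo⁺₁ id n (λ i<j _ → i<j)))

length-oneTo : ∀ n → length (oneTo n) ≡ n
length-oneTo n = trans (length-map suc (upTo n)) (length-applyUpTo _ n)

data Parity : ℕ → Set where
  even : ∀ m → Parity (2 * m)
  odd  : ∀ m → Parity (suc (2 * m))

parity : ∀ n → Parity n
parity zero    = even 0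
parity (suc n) with parity n
... | even m = odd m
... | odd  m = subst Parity (cong suc (+-suc m (m + 0))) (even (suc m))

2*m/2≡m : ∀ m → 2 * m / 2 ≡ m
2*m/2≡m m = trans (cong (_/ 2) (*-comm 2 m)) (m*n/n≡m m 2)

[1+2*m]/2≡m : ∀ m → suc (2 * m) / 2 ≡ m
[1+2*m]/2≡m m = trans (+-distrib-/-∣ʳ 1 (divides m (*-comm 2 m))) (2*m/2≡m m)

corollary7p6 : (n : ℕ) → Σ (List (List ℕ)) (λ L →
    Unique L × (∀ π → (π ∈ L) ⇔ J321 n π) × length L ≡ catalan (n / 2))
corollary7p6 n with parity n
... | even m = subst (Enumeration (J321 (2 * m))) (cong catalan (sym (2*m/2≡m m)))
                 (jacobi321-even m (oneTo-increasing (2 * m)) (length-oneTo (2 * m)))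
... | odd m  = subst (Enumeration (J321 (suc (2 * m)))) (cong catalan (sym ([1+2*m]/2≡m m)))
                 (jacobi321-odd m (oneTo-increasing (suc (2 * m))) (suc-injective (length-oneTo (suc (2 * m)))))
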